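{- Let $G$ be a graph and $d\geq 1$. If $v_1,\ldots,v_d\in V(G)$ all have degree at least $d$, then $S=\{v_1,\ldots,v_d\}$ is a ZIr-set of $G$.
   Context: All graphs are simple, undirected, finite, with nonempty vertex set. A fort of $G$ is a nonempty $F\subseteq V(G)$ such that every $v\in V(G)\setminus F$ has $|F\cap N(v)|\neq 1$ ($N(v)$ the open neighborhood). For $S\subseteq V(G)$ and $x\in S$, a private fort of $x$ relative to $S$ is a fort $F$ with $S\cap F=\{x\}$. $S$ is a ZIr-set if every element of $S$ has a private fort relative to $S$. -}

module Defs where

open import Data.Nat using (ℕ; _≤_)
open import Data.Bool using (Bool; true; false)
open import Data.Fin using (Fin)
open import Data.Fin.Subset using (Subset; _∈_; _∉_; _∩_; ∣_∣; ⁅_⁆; Nonempty)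
open import Data.Vec using (tabulate)
open import Data.Product using (Σ; ∃; _×_)
open import Relation.Binary.PropositionalEquality using (_≡_; _≢_)

record Graph (n : ℕ) : Set where
  field
    adj   : Fin n → Fin n → Bool
    sym   : ∀ u v → adj u v ≡ adj v u
    irrefl : ∀ v → adj v v ≡ false

open Graph public

N : ∀ {n} → Graph n → Fin n → Subset n
N G v = tabulate (λ u → adj G v u)

degree : ∀ {n} → Graph n → Fin n → ℕ
degree G v = ∣ N G v ∣

IsFort : ∀ {n} → Graph n → Subset n → Set
IsFort G F = Nonempty F × (∀ v → v ∉ F → ∣ F ∩ N G v ∣ ≢ 1)

IsPrivateFort : ∀ {n} → Graph n → Subset n → Fin n → Subset n → Set
IsPrivateFort G S x F = IsFort G F × (S ∩ F ≡ ⁅ x ⁆)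

IsZIrSet : ∀ {n} → Graph n → Subset n → Set
IsZIrSet G S = ∀ x → x ∈ S → Σ (Subset _) (λ F → IsPrivateFort G S x F)

{-# OPTIONS --safe #-}
-- The private fort of x ∈ S is F = (V ∖ S) ∪ {x}. A vertex w outside F lies in
-- S ∖ {x}, so at most ∣ S ∣ - 2 of its neighbours are outside F; a degree of at
-- least ∣ S ∣ therefore leaves w with at least two neighbours in F.
module Submission where

open import Defs
open import Data.Nat using (ℕ; zero; suc; _+_; _≤_; _<_; s≤s; z≤n)
open import Data.Nat.Properties
  using (≤-trans; <-irrefl; +-suc; +-monoʳ-≤; n≤1+n; module ≤-Reasoning)
open import Data.Fin using (Fin; zero; suc; _≟_)
open import Data.Fin.Subset
  using (Subset; _∈_; _∉_; _∩_; _∪_; _─_; _-_; ∁; ⁅_⁆; ∣_∣; _⊆_; ⊥; Nonempty; inside; outside)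
open import Data.Fin.Subset.Properties
  using ( _∈?_; ⊆-antisym; p⊆q⇒∣p∣≤∣q∣; ∣⊥∣≡0; x∈⁅x⁆; x∈⁅y⁆⇒x≡y; ∣⁅x⁆∣≡1
        ; x∈p∪q⁺; x∈p∪q⁻; x∈p∩q⁺; x∈p∩q⁻; x∈∁p⇒x∉p; x∉p⇒x∈∁p; x∉∁p⇒x∈p
        ; p─q⊆p; x∈p∧x≢y⇒x∈p-y; x∈p⇒∣p-x∣<∣p∣ )
open import Data.Vec using (_∷_; []; here; there)
open import Data.Vec.Properties using ([]=⇒lookup; lookup∘tabulate)
open import Data.Product using (∃; _,_)
open import Data.Sum using (inj₁; inj₂)
open import Data.Bool using (true)
open import Function using (_∘_)
open import Function.Definitions using (Injective)
open import Function.Bundles using (_⇔_; Equivalence)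
open import Relation.Nullary using (yes; no; contradiction)
open import Relation.Binary.PropositionalEquality using (_≡_; _≢_; refl; trans; cong)
  renaming (sym to ≡-sym)

∣p∪q∣≤∣p∣+∣q∣ : ∀ {n} (p q : Subset n) → ∣ p ∪ q ∣ ≤ ∣ p ∣ + ∣ q ∣
∣p∪q∣≤∣p∣+∣q∣ []            []            = z≤n
∣p∪q∣≤∣p∣+∣q∣ (outside ∷ p) (outside ∷ q) = ∣p∪q∣≤∣p∣+∣q∣ p q
∣p∪q∣≤∣p∣+∣q∣ (outside ∷ p) (inside  ∷ q) rewrite +-suc ∣ p ∣ ∣ q ∣ = s≤s (∣p∪q∣≤∣p∣+∣q∣ p q)
∣p∪q∣≤∣p∣+∣q∣ (inside  ∷ p) (outside ∷ q) = s≤s (∣p∪q∣≤∣p∣+∣q∣ p q)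
∣p∪q∣≤∣p∣+∣q∣ (inside  ∷ p) (inside  ∷ q) =
  s≤s (≤-trans (∣p∪q∣≤∣p∣+∣q∣ p q) (+-monoʳ-≤ ∣ p ∣ (n≤1+n ∣ q ∣)))

x∈p─q⇒x∉q : ∀ {n} {x : Fin n} (p q : Subset n) → x ∈ p ─ q → x ∉ q
x∈p─q⇒x∉q (_ ∷ p) (inside ∷ q) () here
x∈p─q⇒x∉q (_ ∷ p) (_      ∷ q) (there x∈p─q) (there x∈q) = x∈p─q⇒x∉q p q x∈p─q x∈q

p⊆image⇒∣p∣≤m : ∀ {m n} {p : Subset n} (f : Fin m → Fin n) →
                (∀ {x} → x ∈ p → ∃ λ i → f i ≡ x) → ∣ p ∣ ≤ m
p⊆image⇒∣p∣≤m {zero} {n} {p} f covered = begin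
  ∣ p ∣          ≤⟨ p⊆q⇒∣p∣≤∣q∣ p⊆⊥ ⟩
  ∣ ⊥ {n = n} ∣  ≡⟨ ∣⊥∣≡0 n ⟩
  0              ∎
  where
  open ≤-Reasoning
  p⊆⊥ : p ⊆ ⊥
  p⊆⊥ x∈p with covered x∈p
  ... | () , _
p⊆image⇒∣p∣≤m {suc m} {p = p} f covered = begin
  ∣ p ∣                               ≤⟨ p⊆q⇒∣p∣≤∣q∣ split ⟩
  ∣ ⁅ f zero ⁆ ∪ (p - f zero) ∣       ≤⟨ ∣p∪q∣≤∣p∣+∣q∣ ⁅ f zero ⁆ (p - f zero) ⟩
  ∣ ⁅ f zero ⁆ ∣ + ∣ p - f zero ∣     ≡⟨ cong (_+ ∣ p - f zero ∣) (∣⁅x⁆∣≡1 (f zero)) ⟩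
  suc ∣ p - f zero ∣                  ≤⟨ s≤s (p⊆image⇒∣p∣≤m (f ∘ suc) coveredByTail) ⟩
  suc m                               ∎
  where
  open ≤-Reasoning
  split : p ⊆ ⁅ f zero ⁆ ∪ (p - f zero)
  split {x} x∈p with x ≟ f zero
  ... | yes refl  = x∈p∪q⁺ (inj₁ (x∈⁅x⁆ x))
  ... | no  x≢f₀ = x∈p∪q⁺ (inj₂ (x∈p∧x≢y⇒x∈p-y x∈p x≢f₀))
  coveredByTail : ∀ {x} → x ∈ p - f zero → ∃ λ i → f (suc i) ≡ x
  coveredByTail x∈p-f₀ with covered (p─q⊆p p ⁅ f zero ⁆ x∈p-f₀)
  ... | zero  , refl = contradiction (x∈⁅x⁆ (f zero)) (x∈p─q⇒x∉q p ⁅ f zero ⁆ x∈p-f₀)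
  ... | suc i , fi≡x = i , fi≡x

module _ {n} (G : Graph n) where

  ∈N⇒adj : ∀ {v u} → u ∈ N G v → adj G v u ≡ true
  ∈N⇒adj {v} {u} u∈Nv = trans (≡-sym (lookup∘tabulate (adj G v) u)) ([]=⇒lookup u∈Nv)

  v∉Nv : ∀ v → v ∉ N G v
  v∉Nv v v∈Nv with trans (≡-sym (∈N⇒adj v∈Nv)) (irrefl G v)
  ... | ()

  N⊆F∩N∪∁F-v : ∀ F v → N G v ⊆ (F ∩ N G v) ∪ (∁ F - v)
  N⊆F∩N∪∁F-v F v {u} u∈Nv with u ∈? F
  ... | yes u∈F = x∈p∪q⁺ (inj₁ (x∈p∩q⁺ (u∈F , u∈Nv)))
  ... | no  u∉F = x∈p∪q⁺ (inj₂ (x∈p∧x≢y⇒x∈p-y (x∉p⇒x∈∁p u∉F) u≢v))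
    where
    u≢v : u ≢ v
    u≢v refl = v∉Nv u u∈Nv

  ∣∁F∣<degree⇒IsFort : ∀ {F} → Nonempty F → (∀ w → w ∉ F → ∣ ∁ F ∣ < degree G w) → IsFort G F
  ∣∁F∣<degree⇒IsFort {F} F≢∅ large = F≢∅ , notExactlyOne
    where
    notExactlyOne : ∀ w → w ∉ F → ∣ F ∩ N G w ∣ ≢ 1
    notExactlyOne w w∉F one = <-irrefl refl (begin-strict
      ∣ ∁ F ∣                              <⟨ large w w∉F ⟩
      degree G w                           ≤⟨ p⊆q⇒∣p∣≤∣q∣ (N⊆F∩N∪∁F-v F w) ⟩
      ∣ (F ∩ N G w) ∪ (∁ F - w) ∣          ≤⟨ ∣p∪q∣≤∣p∣+∣q∣ (F ∩ N G w) (∁ F - w) ⟩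
      ∣ F ∩ N G w ∣ + ∣ ∁ F - w ∣          ≡⟨ cong (_+ ∣ ∁ F - w ∣) one ⟩
      suc ∣ ∁ F - w ∣                      ≤⟨ x∈p⇒∣p-x∣<∣p∣ (x∉p⇒x∈∁p w∉F) ⟩
      ∣ ∁ F ∣                              ∎)
      where open ≤-Reasoning

  ∣S∣≤degree⇒IsPrivateFort : ∀ {S x} → x ∈ S → (∀ w → w ∈ S → w ≢ x → ∣ S ∣ ≤ degree G w) →
                             IsPrivateFort G S x (∁ S ∪ ⁅ x ⁆)
  ∣S∣≤degree⇒IsPrivateFort {S} {x} x∈S large =
    ∣∁F∣<degree⇒IsFort (x , x∈F) outsideLarge , ⊆-antisym S∩F⊆⁅x⁆ ⁅x⁆⊆S∩F
    where
    F : Subset n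
    F = ∁ S ∪ ⁅ x ⁆
    x∈F : x ∈ F
    x∈F = x∈p∪q⁺ (inj₂ (x∈⁅x⁆ x))
    ∉F⇒∈S : ∀ {u} → u ∉ F → u ∈ S
    ∉F⇒∈S u∉F = x∉∁p⇒x∈p (u∉F ∘ x∈p∪q⁺ ∘ inj₁)
    ∉F⇒≢x : ∀ {u} → u ∉ F → u ≢ x
    ∉F⇒≢x u∉F refl = u∉F x∈F
    ∁F⊆S-x : ∁ F ⊆ S - x
    ∁F⊆S-x u∈∁F = let u∉F = x∈∁p⇒x∉p u∈∁F in x∈p∧x≢y⇒x∈p-y (∉F⇒∈S u∉F) (∉F⇒≢x u∉F)
    outsideLarge : ∀ w → w ∉ F → ∣ ∁ F ∣ < degree G w
    outsideLarge w w∉F = begin-strict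
      ∣ ∁ F ∣     ≤⟨ p⊆q⇒∣p∣≤∣q∣ ∁F⊆S-x ⟩
      ∣ S - x ∣   <⟨ x∈p⇒∣p-x∣<∣p∣ x∈S ⟩
      ∣ S ∣       ≤⟨ large w (∉F⇒∈S w∉F) (∉F⇒≢x w∉F) ⟩
      degree G w  ∎
      where open ≤-Reasoning
    S∩F⊆⁅x⁆ : S ∩ F ⊆ ⁅ x ⁆
    S∩F⊆⁅x⁆ u∈S∩F with x∈p∩q⁻ S F u∈S∩F
    ... | u∈S , u∈F with x∈p∪q⁻ (∁ S) ⁅ x ⁆ u∈F
    ...   | inj₁ u∈∁S = contradiction u∈S (x∈∁p⇒x∉p u∈∁S)
    ...   | inj₂ u∈⁅x⁆ = u∈⁅x⁆
    ⁅x⁆⊆S∩F : ⁅ x ⁆ ⊆ S ∩ F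
    ⁅x⁆⊆S∩F u∈⁅x⁆ with x∈⁅y⁆⇒x≡y x u∈⁅x⁆
    ... | refl = x∈p∩q⁺ (x∈S , x∈F)

  ∣S∣≤degree⇒IsZIrSet : ∀ {S} → (∀ w → w ∈ S → ∣ S ∣ ≤ degree G w) → IsZIrSet G S
  ∣S∣≤degree⇒IsZIrSet {S} large x x∈S =
    ∁ S ∪ ⁅ x ⁆ , ∣S∣≤degree⇒IsPrivateFort x∈S (λ w w∈S _ → large w w∈S)

proposition2p10 : ∀ {n} (G : Graph n) (d : ℕ) → 1 ≤ d →
    (v : Fin d → Fin n) → Injective _≡_ _≡_ v →
    (∀ i → d ≤ degree G (v i)) →
    (S : Subset n) → (∀ u → (u ∈ S) ⇔ (∃ λ i → v i ≡ u)) →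
    IsZIrSet G S
proposition2p10 G d _ v _ degree≥d S S≡image = ∣S∣≤degree⇒IsZIrSet G ∣S∣≤degree
  where
  covered : ∀ {u} → u ∈ S → ∃ λ i → v i ≡ u
  covered {u} = Equivalence.to (S≡image u)
  ∣S∣≤degree : ∀ w → w ∈ S → ∣ S ∣ ≤ degree G w
  ∣S∣≤degree w w∈S with covered w∈S
  ... | i , refl = ≤-trans (p⊆image⇒∣p∣≤m v covered) (degree≥d i)
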